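{- If $n\in\mathbb{N}$ is a composite number, then there exists an integer $c$ with $1<c<n$ and $c\mid n$ such that $\delta(\mathcal{G}(\mathbb{Z}_n))=\deg(\overline{c})$.
   Context: $\mathbb{Z}_n=\{\overline{0},\dots,\overline{n-1}\}$ is the additive group of integers modulo $n$. The power graph $\mathcal{G}(G)$ of a group $G$ has vertex set $G$, distinct $u,v$ adjacent iff one is a (positive integer) power, i.e. multiple in additive notation, of the other. $\delta$ denotes minimum degree. -}

module Defs where

open import Data.Nat using (ℕ; zero; suc; _*_; _≤_; NonZero)
open import Data.Nat.DivMod using (_%_)
open import Data.Fin using (Fin; toℕ)
open import Data.Product using (Σ; ∃; _×_; _,_)
open import Data.Sum using (_⊎_)
open import Data.List using (List; length)
open import Data.List.Membership.Propositional using (_∈_)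
open import Data.List.Relation.Unary.Unique.Propositional using (Unique)
open import Relation.Binary.PropositionalEquality using (_≡_; _≢_)

-- Z_n is modelled by Fin n (residues 0..n-1); k • x is the additive multiple k·x in Z_n.
-- (Fin 0 is empty, so only n = suc m matters; the modulus is then suc m.)
_•_ : {n : ℕ} → ℕ → Fin n → ℕ
_•_ {suc m} k x = (k * toℕ x) % suc m

IsMultipleOf : {n : ℕ} → Fin n → Fin n → Set
IsMultipleOf {n} v u = ∃ λ k → (1 ≤ k) × (toℕ v ≡ k • u)

-- adjacency in the power graph G(Z_n): distinct, and one is a power of the other
Adj : {n : ℕ} → Fin n → Fin n → Set
Adj u v = (u ≢ v) × (IsMultipleOf v u ⊎ IsMultipleOf u v)

HasDegree : {n : ℕ} → Fin n → ℕ → Set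
HasDegree {n} x d =
  Σ (List (Fin n)) λ ns →
    Unique ns × ((y : Fin n) → (y ∈ ns → Adj x y) × (Adj x y → y ∈ ns)) × (length ns ≡ d)

HasMinDegree : (n : ℕ) → ℕ → Set
HasMinDegree n m =
  (∃ λ (x : Fin n) → HasDegree x m) × ((y : Fin n) (d : ℕ) → HasDegree y d → m ≤ d)

-- Write N = suc m and identify Z_N with Fin N.  Two vertices u, v are
-- *comparable* when one is a multiple of the other; adjacency is
-- comparability of distinct vertices, so the closed neighbourhood of u is
-- exactly the set of vertices comparable to u.
--
--  * Degrees are computed: adjacency is decidable (a multiplier can be reduced
--    mod N), so the neighbours of x form a duplicate-free list, and every
--    duplicate-free list of neighbours has at least that length.
--  * Degrees are compared through closed neighbourhoods: if N[a] ⊆ N[b] then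
--    deg a ≤ deg b.  Hence two vertices which are multiples of each other
--    have the same degree, and a vertex comparable to everything (0 or 1)
--    has maximal degree.
--  * For any vertex x let g = gcd(x, N).  By Bézout, g is a multiple of x,
--    and x is a multiple of g, so deg g ≤ deg x.  If 1 < g < N, g is the
--    required divisor; otherwise x = 0 or g = 1 is a universal vertex, and
--    any proper divisor d of N (one exists since N is composite) satisfies
--    deg d ≤ deg x.  Applied to a vertex of minimum degree, this gives the
--    theorem.
module Submission where

open import Defs
open import Data.Nat as ℕ using (ℕ; zero; suc; _+_; _*_; _≤_; _<_; _<?_; z≤n; s≤s; s≤s⁻¹)
open import Data.Nat.Properties hiding (_≟_)
open import Data.Nat.DivMod
open import Data.Nat.Divisibility using (_∣_; divides; ∣⇒≤; 0∣⇒≡0; ∣-refl; n∣m⇒m%n≡0; _∣0; 1∣_)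
open import Data.Nat.GCD using (gcd; gcd-GCD; gcd[m,n]∣m; gcd[m,n]∣n; module Bézout)
open import Data.Nat.Primality using (Composite; composite)
open import Data.Nat.Base using (nonTrivial⇒n>1)
open import Data.Nat.Tactic.RingSolver using (solve-∀)
open import Data.Fin as Fin using (Fin; toℕ; fromℕ<; _≟_)
open import Data.Fin.Properties using (toℕ<n; toℕ-fromℕ<; any?)
open import Data.Product using (Σ; ∃; _×_; _,_; proj₁; proj₂)
open import Data.Sum using (_⊎_; inj₁; inj₂)
open import Data.Empty using (⊥-elim)
open import Data.List using (List; []; _∷_; length; filter; allFin; _++_)
open import Data.List.Properties using (length-++-sucʳ)
open import Data.List.Extrema.Nat using (argmin; f[argmin]≤f[xs])
open import Data.List.Membership.Propositional using (_∈_)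
open import Data.List.Membership.Propositional.Properties
  using (∈-∃++; ∈-++⁻; ∈-++⁺ˡ; ∈-++⁺ʳ; ∈-filter⁺; ∈-filter⁻; ∈-allFin)
open import Data.List.Relation.Binary.Subset.Propositional using (_⊆_)
open import Data.List.Relation.Unary.Any using (here; there)
import Data.List.Relation.Unary.All as All
open import Data.List.Relation.Unary.AllPairs using (_∷_)
open import Data.List.Relation.Unary.Unique.Propositional using (Unique)
open import Data.List.Relation.Unary.Unique.Propositional.Properties using (filter⁺; allFin⁺)
open import Relation.Nullary using (Dec; yes; no; ¬_)
open import Relation.Nullary.Decidable using (_×-dec_; _⊎-dec_; ¬?; map′)
open import Relation.Binary.PropositionalEquality

private
  variable
    m : ℕ

%-absorbˡ : ∀ a b N .{{_ : ℕ.NonZero N}} → (a % N * b) % N ≡ (a * b) % N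
%-absorbˡ a b N = begin
  (a % N * b) % N              ≡⟨ %-distribˡ-* (a % N) b N ⟩
  (a % N % N * (b % N)) % N    ≡⟨ cong (λ t → (t * (b % N)) % N) (m%n%n≡m%n a N) ⟩
  (a % N * (b % N)) % N        ≡⟨ sym (%-distribˡ-* a b N) ⟩
  (a * b) % N                  ∎
  where open ≡-Reasoning

%-absorbʳ : ∀ a b N .{{_ : ℕ.NonZero N}} → (a * (b % N)) % N ≡ (a * b) % N
%-absorbʳ a b N = begin
  (a * (b % N)) % N  ≡⟨ cong (_% N) (*-comm a (b % N)) ⟩
  (b % N * a) % N    ≡⟨ %-absorbˡ b a N ⟩
  (b * a) % N        ≡⟨ cong (_% N) (*-comm b a) ⟩
  (a * b) % N        ∎
  where open ≡-Reasoning

-- Bézout modulo N: gcd(x, N) is congruent to a multiple of x.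
gcd-≡-multiple : ∀ x m → ∃ λ k → gcd x (suc m) % suc m ≡ (k * x) % suc m
gcd-≡-multiple x m with Bézout.identity (gcd-GCD x (suc m))
... | Bézout.+- a b eq = a , (begin
  g % N              ≡⟨ sym ([m+kn]%n≡m%n g b N) ⟩
  (g + b * N) % N    ≡⟨ cong (_% N) eq ⟩
  (a * x) % N        ∎)
  where open ≡-Reasoning
        N = suc m
        g = gcd x N
... | Bézout.-+ a b eq = a * m , (begin
  g % N                            ≡⟨ sym ([m+kn]%n≡m%n g (a * x) N) ⟩
  (g + a * x * N) % N              ≡⟨ cong (_% N) (regroup g a x m) ⟩
  (a * m * x + (g + a * x)) % N    ≡⟨ cong (λ t → (a * m * x + t) % N) eq ⟩
  (a * m * x + b * N) % N          ≡⟨ [m+kn]%n≡m%n (a * m * x) b N ⟩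
  (a * m * x) % N                  ∎)
  where open ≡-Reasoning
        N = suc m
        g = gcd x N
        -- a·x·N = a·(N-1)·x + a·x, since N = suc m
        regroup : ∀ g a x m → g + a * x * suc m ≡ a * m * x + (g + a * x)
        regroup = solve-∀

-- Any multiplier, even 0, witnesses a positive multiple: k and k + N act alike.
multiple-by : {u v : Fin (suc m)} (k : ℕ) → toℕ v ≡ k • u → IsMultipleOf v u
multiple-by {m} {u} k e = k + suc m , ≤-trans (s≤s z≤n) (m≤n+m (suc m) k) , trans e (sym shift)
  where
  shift : ((k + suc m) * toℕ u) % suc m ≡ (k * toℕ u) % suc m
  shift = begin
    ((k + suc m) * toℕ u) % suc m            ≡⟨ cong (_% suc m) (*-distribʳ-+ (toℕ u) k (suc m)) ⟩
    (k * toℕ u + suc m * toℕ u) % suc m      ≡⟨ cong (λ t → (k * toℕ u + t) % suc m) (*-comm (suc m) (toℕ u)) ⟩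
    (k * toℕ u + toℕ u * suc m) % suc m      ≡⟨ [m+kn]%n≡m%n (k * toℕ u) (toℕ u) (suc m) ⟩
    (k * toℕ u) % suc m                      ∎
    where open ≡-Reasoning

multiple-trans : {x y z : Fin (suc m)} → IsMultipleOf z y → IsMultipleOf y x → IsMultipleOf z x
multiple-trans {m} {x} {y} {z} (k , _ , ez) (j , _ , ey) = multiple-by (k * j) (begin
  toℕ z                                   ≡⟨ ez ⟩
  (k * toℕ y) % suc m                     ≡⟨ cong (λ t → (k * t) % suc m) ey ⟩
  (k * ((j * toℕ x) % suc m)) % suc m     ≡⟨ %-absorbʳ k (j * toℕ x) (suc m) ⟩
  (k * (j * toℕ x)) % suc m               ≡⟨ cong (_% suc m) (sym (*-assoc k j (toℕ x))) ⟩
  (k * j * toℕ x) % suc m                 ∎)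
  where open ≡-Reasoning

divisor⇒multiple : {x c : Fin (suc m)} → toℕ c ∣ toℕ x → IsMultipleOf x c
divisor⇒multiple {m} {x} {c} (divides q eq) =
  multiple-by q (trans (sym (m<n⇒m%n≡m (toℕ<n x))) (cong (_% suc m) eq))

multiple-refl : (u : Fin (suc m)) → IsMultipleOf u u
multiple-refl u = divisor⇒multiple ∣-refl

gcd⇒multiple : {x c : Fin (suc m)} → toℕ c ≡ gcd (toℕ x) (suc m) → IsMultipleOf c x
gcd⇒multiple {m} {x} {c} ec with gcd-≡-multiple (toℕ x) m
... | k , eq = multiple-by k (begin
  toℕ c                           ≡⟨ sym (m<n⇒m%n≡m (toℕ<n c)) ⟩
  toℕ c % suc m                   ≡⟨ cong (_% suc m) ec ⟩
  gcd (toℕ x) (suc m) % suc m     ≡⟨ eq ⟩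
  (k * toℕ x) % suc m             ∎)
  where open ≡-Reasoning

-- Being a multiple is decidable: the multiplier k may be replaced by k mod N.
multiple? : (v u : Fin (suc m)) → Dec (IsMultipleOf v u)
multiple? {m} v u =
  map′ (λ (k , e) → multiple-by (toℕ k) e) reduce
       (any? (λ (k : Fin (suc m)) → toℕ v ℕ.≟ toℕ k • u))
  where
  reduce : IsMultipleOf v u → ∃ λ (k : Fin (suc m)) → toℕ v ≡ toℕ k • u
  reduce (k , _ , e) = fromℕ< (m%n<n k (suc m)) , (begin
    toℕ v                                                    ≡⟨ e ⟩
    (k * toℕ u) % suc m                                      ≡⟨ sym (%-absorbˡ k (toℕ u) (suc m)) ⟩
    (k % suc m * toℕ u) % suc m                              ≡⟨ cong (λ t → (t * toℕ u) % suc m)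
                                                                 (sym (toℕ-fromℕ< (m%n<n k (suc m)))) ⟩
    (toℕ (fromℕ< (m%n<n k (suc m))) * toℕ u) % suc m         ∎)
    where open ≡-Reasoning

adjacent? : (x y : Fin (suc m)) → Dec (Adj x y)
adjacent? x y = ¬? (x ≟ y) ×-dec (multiple? y x ⊎-dec multiple? x y)

unique-⊆-length : {A : Set} (xs ys : List A) → Unique xs → xs ⊆ ys → length xs ≤ length ys
unique-⊆-length [] ys _ _ = z≤n
unique-⊆-length (x ∷ xs) ys (x∉xs ∷ xs!) xs⊆ys with ∈-∃++ (xs⊆ys (here refl))
... | as , bs , refl = subst (suc (length xs) ≤_) (sym (length-++-sucʳ as x bs))
  (s≤s (unique-⊆-length xs (as ++ bs) xs! (λ z∈xs →
    remove (xs⊆ys (there z∈xs)) (λ { refl → All.lookup x∉xs z∈xs refl }))))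
  where
  remove : ∀ {z} → z ∈ as ++ x ∷ bs → z ≢ x → z ∈ as ++ bs
  remove z∈ z≢x with ∈-++⁻ as z∈
  ... | inj₁ p = ∈-++⁺ˡ p
  ... | inj₂ (here z≡x) = ⊥-elim (z≢x z≡x)
  ... | inj₂ (there p) = ∈-++⁺ʳ as p

neighbours : Fin (suc m) → List (Fin (suc m))
neighbours {m} x = filter (adjacent? x) (allFin (suc m))

neighbours-unique : (x : Fin (suc m)) → Unique (neighbours x)
neighbours-unique {m} x = filter⁺ (adjacent? x) (allFin⁺ (suc m))

∈-neighbours⁻ : {x y : Fin (suc m)} → y ∈ neighbours x → Adj x y
∈-neighbours⁻ {x = x} y∈ = proj₂ (∈-filter⁻ (adjacent? x) y∈)

∈-neighbours⁺ : {x y : Fin (suc m)} → Adj x y → y ∈ neighbours x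
∈-neighbours⁺ {x = x} {y} adj = ∈-filter⁺ (adjacent? x) (∈-allFin y) adj

degree : Fin (suc m) → ℕ
degree x = length (neighbours x)

degree-spec : (x : Fin (suc m)) → HasDegree x (degree x)
degree-spec x = neighbours x , neighbours-unique x , (λ y → ∈-neighbours⁻ , ∈-neighbours⁺) , refl

degree-least : {x : Fin (suc m)} {d : ℕ} → HasDegree x d → degree x ≤ d
degree-least {x = x} (ns , _ , spec , refl) =
  unique-⊆-length (neighbours x) ns (neighbours-unique x) (λ {y} y∈ → proj₂ (spec y) (∈-neighbours⁻ y∈))

Comparable : Fin (suc m) → Fin (suc m) → Set
Comparable x y = IsMultipleOf y x ⊎ IsMultipleOf x y

comparable⇒closed : {x y : Fin (suc m)} → Comparable x y → y ≡ x ⊎ Adj x y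
comparable⇒closed {x = x} {y} c with y ≟ x
... | yes y≡x = inj₁ y≡x
... | no y≢x = inj₂ ((λ x≡y → y≢x (sym x≡y)) , c)

closed⇒comparable : {x y : Fin (suc m)} → y ≡ x ⊎ Adj x y → Comparable x y
closed⇒comparable {x = x} (inj₁ refl) = inj₁ (multiple-refl x)
closed⇒comparable (inj₂ (_ , c)) = c

-- Inclusion of closed neighbourhoods bounds degrees: x ∷ neighbours x is
-- duplicate-free (x is not its own neighbour) and lists N[x].
degree-mono : (a b : Fin (suc m)) → (∀ {y} → Comparable a y → Comparable b y) → degree a ≤ degree b
degree-mono a b sub = s≤s⁻¹ (unique-⊆-length (a ∷ neighbours a) (b ∷ neighbours b)
  (All.tabulate (λ y∈ → proj₁ (∈-neighbours⁻ y∈)) ∷ neighbours-unique a)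
  (λ y∈ → closed-∈ (comparable⇒closed (sub (closed⇒comparable (∈-closed y∈))))))
  where
  ∈-closed : ∀ {y} → y ∈ a ∷ neighbours a → y ≡ a ⊎ Adj a y
  ∈-closed (here y≡a) = inj₁ y≡a
  ∈-closed (there y∈) = inj₂ (∈-neighbours⁻ y∈)
  closed-∈ : ∀ {y} → y ≡ b ⊎ Adj b y → y ∈ b ∷ neighbours b
  closed-∈ (inj₁ y≡b) = here y≡b
  closed-∈ (inj₂ adj) = there (∈-neighbours⁺ adj)

-- If a and b are multiples of each other then N[a] ⊆ N[b] (and symmetrically).
mutual-multiples-degree : {a b : Fin (suc m)} → IsMultipleOf a b → IsMultipleOf b a → degree a ≤ degree b
mutual-multiples-degree {a = a} {b} a∈⟨b⟩ b∈⟨a⟩ = degree-mono a b λ where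
  (inj₁ y∈⟨a⟩) → inj₁ (multiple-trans y∈⟨a⟩ a∈⟨b⟩)
  (inj₂ a∈⟨y⟩) → inj₂ (multiple-trans b∈⟨a⟩ a∈⟨y⟩)

universal-degree : {u : Fin (suc m)} → (∀ y → Comparable u y) → (c : Fin (suc m)) → degree c ≤ degree u
universal-degree {u = u} univ c = degree-mono c u (λ {y} _ → univ y)

zero-universal : {u : Fin (suc m)} → toℕ u ≡ 0 → ∀ y → Comparable u y
zero-universal u≡0 y = inj₂ (divisor⇒multiple (subst (toℕ y ∣_) (sym u≡0) (toℕ y ∣0)))

one-universal : {u : Fin (suc m)} → toℕ u ≡ 1 → ∀ y → Comparable u y
one-universal u≡1 y = inj₁ (divisor⇒multiple (subst (_∣ toℕ y) (sym u≡1) (1∣ toℕ y)))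

DivisorBelow : Fin (suc m) → Set
DivisorBelow {m} x =
  Σ ℕ λ c → Σ (1 < c) λ _ → Σ (c < suc m) λ c<N → (c ∣ suc m) × (degree (fromℕ< c<N) ≤ degree x)

-- gcd(x, N) = N forces x = 0, since N ∣ x < N.
gcd≡N⇒zero : (x : Fin (suc m)) → gcd (toℕ x) (suc m) ≡ suc m → toℕ x ≡ 0
gcd≡N⇒zero {m} x g≡N = trans (sym (m<n⇒m%n≡m (toℕ<n x)))
  (n∣m⇒m%n≡0 (toℕ x) (suc m) (subst (_∣ toℕ x) g≡N (gcd[m,n]∣m (toℕ x) (suc m))))

gcd<N : (x : Fin (suc m)) → gcd (toℕ x) (suc m) ≢ suc m → gcd (toℕ x) (suc m) < suc m
gcd<N {m} x g≢N = ≤∧≢⇒< (∣⇒≤ (gcd[m,n]∣n (toℕ x) (suc m))) g≢N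

gcd≯1⇒≡1 : (x : Fin (suc m)) → ¬ (1 < gcd (toℕ x) (suc m)) → gcd (toℕ x) (suc m) ≡ 1
gcd≯1⇒≡1 {m} x g≯1 = ≤-antisym (≮⇒≥ g≯1)
  (n≢0⇒n>0 (λ g≡0 → 1+n≢0 (0∣⇒≡0 (subst (_∣ suc m) g≡0 (gcd[m,n]∣n (toℕ x) (suc m))))))

-- x and the vertex gcd(x, N) are multiples of each other.
gcd-vertex-degree : (x : Fin (suc m)) (g<N : gcd (toℕ x) (suc m) < suc m) → degree (fromℕ< g<N) ≤ degree x
gcd-vertex-degree {m} x g<N = mutual-multiples-degree (gcd⇒multiple (toℕ-fromℕ< g<N))
  (divisor⇒multiple (subst (_∣ toℕ x) (sym (toℕ-fromℕ< g<N)) (gcd[m,n]∣m (toℕ x) (suc m))))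

-- Given some proper divisor d of N, every vertex x is dominated by a proper
-- divisor: gcd(x, N) if it is proper, and otherwise d, because then x or
-- gcd(x, N) = 1 is a universal vertex.
divisor-below : {d : ℕ} → 1 < d → (d<N : d < suc m) → d ∣ suc m → (x : Fin (suc m)) → DivisorBelow x
divisor-below {m} {d} 1<d d<N d∣N x with gcd (toℕ x) (suc m) ℕ.≟ suc m
... | yes g≡N = d , 1<d , d<N , d∣N , universal-degree (zero-universal (gcd≡N⇒zero x g≡N)) (fromℕ< d<N)
... | no g≢N with 1 <? gcd (toℕ x) (suc m)
...   | yes 1<g = gcd (toℕ x) (suc m) , 1<g , gcd<N x g≢N , gcd[m,n]∣n (toℕ x) (suc m) ,
                  gcd-vertex-degree x (gcd<N x g≢N)
...   | no g≯1 = d , 1<d , d<N , d∣N , ≤-trans (universal-degree g-universal (fromℕ< d<N))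
                                                (gcd-vertex-degree x (gcd<N x g≢N))
  where
  g-universal : ∀ y → Comparable (fromℕ< (gcd<N x g≢N)) y
  g-universal = one-universal (trans (toℕ-fromℕ< (gcd<N x g≢N)) (gcd≯1⇒≡1 x g≯1))

IsMinimum : Fin (suc m) → Set
IsMinimum {m} x = (y : Fin (suc m)) → degree x ≤ degree y

minimum-vertex : ∀ m → Σ (Fin (suc m)) IsMinimum
minimum-vertex m = x , λ y → All.lookup (f[argmin]≤f[xs] {f = degree} Fin.zero (allFin (suc m))) (∈-allFin y)
  where
  x : Fin (suc m)
  x = argmin degree Fin.zero (allFin (suc m))

minimum-degree : (x : Fin (suc m)) → IsMinimum x → HasMinDegree (suc m) (degree x)
minimum-degree x x-min =
  (x , degree-spec x) , λ y d deg-y≡d → ≤-trans (x-min y) (degree-least deg-y≡d)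

attains-minimum : (x c : Fin (suc m)) → IsMinimum x → degree c ≤ degree x → HasDegree c (degree x)
attains-minimum x c x-min deg-c≤deg-x =
  subst (HasDegree c) (≤-antisym deg-c≤deg-x (x-min c)) (degree-spec c)

divisor-attains-minimum : {d : ℕ} → 1 < d → (d<N : d < suc m) → d ∣ suc m → Σ (Fin (suc m)) IsMinimum →
  Σ ℕ λ c → Σ (1 < c) λ _ → Σ (c < suc m) λ c<N → (c ∣ suc m) ×
    (Σ ℕ λ k → HasMinDegree (suc m) k × HasDegree (fromℕ< c<N) k)
divisor-attains-minimum 1<d d<N d∣N (x , x-min) with divisor-below 1<d d<N d∣N x
... | c , 1<c , c<N , c∣N , deg-c≤deg-x =
  c , 1<c , c<N , c∣N , degree x , minimum-degree x x-min , attains-minimum x (fromℕ< c<N) x-min deg-c≤deg-x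

lemma4p2 : (n : ℕ) → Composite n →
    Σ ℕ λ c → Σ (1 < c) λ _ → Σ (c < n) λ c<n → (c ∣ n) ×
    (Σ ℕ λ m → HasMinDegree n m × HasDegree (fromℕ< c<n) m)
lemma4p2 zero (composite () _)
lemma4p2 (suc m) (composite {d} d<n d∣n) =
  divisor-attains-minimum (nonTrivial⇒n>1 d) d<n d∣n (minimum-vertex m)
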